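{- Let $n\geq 4$, $k\geq 3$ and $\mathcal{F}\subset\binom{[n]}{k}$. If $\gamma(\mathcal{F})<\frac{n-1}{k}\binom{n-4}{k-3}$, then $\beta(\mathcal{F})<\binom{n-4}{k-3}$.
   Context: $\binom{[n]}{k}$ denotes the family of all $k$-element subsets of $[n]=\{1,\dots,n\}$. For distinct $i,j\in[n]$, let $b_{ij}(\mathcal{F})=|\{F\in\mathcal{F}\colon i\in F,\ j\notin F\}|$; the sturdiness is $\beta(\mathcal{F})=\min_{1\leq i\neq j\leq n} b_{ij}(\mathcal{F})$. The diversity is $\gamma(\mathcal{F})=\min_{y\in[n]}|\{F\in\mathcal{F}\colon y\notin F\}|$. -}

module Defs where

open import Data.Nat using (ℕ; zero; suc; _⊓_)
open import Data.Fin using (Fin; _≟_)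
open import Data.Fin.Subset using (Subset; _∈_; _∉_; ∣_∣)
open import Data.Fin.Subset.Properties using (_∈?_)
open import Data.List using (List; []; _∷_; length; filter; foldr; allFin; concatMap; map)
open import Data.List.Relation.Unary.All using (All)
open import Data.List.Relation.Unary.Unique.Propositional using (Unique)
open import Data.Product using (_×_; _,_; proj₁; proj₂)
open import Relation.Nullary using (¬_; yes; no)
open import Relation.Nullary.Decidable using (_×-dec_; ¬?)
open import Relation.Binary.PropositionalEquality using (_≡_)

IsKFamily : (n k : ℕ) → List (Subset n) → Set
IsKFamily n k 𝓕 = Unique 𝓕 × All (λ F → ∣ F ∣ ≡ k) 𝓕

b : {n : ℕ} → List (Subset n) → Fin n → Fin n → ℕ
b 𝓕 i j = length (filter (λ F → (i ∈? F) ×-dec ¬? (j ∈? F)) 𝓕)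

notContaining : {n : ℕ} → List (Subset n) → Fin n → ℕ
notContaining 𝓕 y = length (filter (λ F → ¬? (y ∈? F)) 𝓕)

minimumOr : ℕ → List ℕ → ℕ
minimumOr d []       = d
minimumOr d (x ∷ xs) = foldr _⊓_ x xs

distinctPairs : (n : ℕ) → List (Fin n × Fin n)
distinctPairs n = concatMap (λ i → map (λ j → (i , j)) (filter (λ j → ¬? (i ≟ j)) (allFin n))) (allFin n)

-- sturdiness β(𝓕) = min_{i ≠ j} b_ij(𝓕)  (index set nonempty when n ≥ 2)
β : {n : ℕ} → List (Subset n) → ℕ
β {n} 𝓕 = minimumOr 0 (map (λ p → b 𝓕 (proj₁ p) (proj₂ p)) (distinctPairs n))

-- diversity γ(𝓕) = min_y |{F ∈ 𝓕 : y ∉ F}|  (index set nonempty when n ≥ 1)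
γ : {n : ℕ} → List (Subset n) → ℕ
γ {n} 𝓕 = minimumOr 0 (map (notContaining 𝓕) (allFin n))

-- Double counting: for a k-uniform family and a fixed point y, summing b_iy over all i counts
-- every F ∌ y exactly |F| = k times, so Σᵢ b_iy = k · |{F : y ∉ F}|.  The n − 1 terms with
-- i ≠ y are each at least β, hence (n − 1) β ≤ k γ, taking y to be a point where γ is attained.
module Submission where

open import Defs
open import Data.Bool using (true; false; if_then_else_)
open import Data.Fin as Fin using (Fin; _≟_; punchIn)
open import Data.Fin.Properties using (punchInᵢ≢i)
open import Data.Fin.Subset using (Subset; ∣_∣; inside; outside)
open import Data.Fin.Subset.Properties using (_∈?_)
open import Data.List using (List; []; _∷_; length; filter; map; allFin)
open import Data.List.Membership.Propositional using (_∈_)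
open import Data.List.Membership.Propositional.Properties
  using (∈-map⁺; ∈-map⁻; ∈-concatMap⁺; ∈-filter⁺; ∈-allFin; foldr-selective)
open import Data.List.Properties using (foldr-preservesᵒ)
open import Data.List.Relation.Unary.All using (All; []; _∷_)
open import Data.List.Relation.Unary.Any as Any using (here; there)
open import Data.Nat using (ℕ; zero; suc; _+_; _*_; _∸_; _≤_; _<_; z≤n)
open import Data.Nat.Combinatorics using (_C_)
open import Data.Nat.Properties as ℕ using
  ( +-*-semiring; ≤-refl; ≤-reflexive; ≤-trans; +-mono-≤; m≤n+m; *-monoʳ-≤
  ; *-distribˡ-+; *-zeroʳ; ⊓-sel; m≤n⇒m⊓o≤n; m≤n⇒o⊓m≤n; <⇒≱; ≰⇒> )
open import Data.Product using (∃; _,_; proj₁; proj₂; map₂)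
open import Data.Sum using (_⊎_; inj₁; inj₂; [_,_]′)
open import Data.Vec using ([]; _∷_)
open import Relation.Binary.PropositionalEquality
  using (_≡_; _≢_; refl; sym; trans; cong; cong₂; module ≡-Reasoning)
open import Relation.Nullary using (Dec; does; yes; no)
open import Relation.Nullary.Decidable using (_×-dec_; ¬?)
open import Algebra.Properties.Semiring.Sum +-*-semiring
  using (sum; sum-syntax; sum-cong-≗; ∑-distrib-+; *-distribʳ-sum; sum-remove; sum-replicate-zero)

𝟙 : ∀ {a} {A : Set a} → Dec A → ℕ
𝟙 a? = if does a? then 1 else 0

𝟙-×-dec : ∀ {a b} {A : Set a} {B : Set b} (a? : Dec A) (b? : Dec B) →
          𝟙 (a? ×-dec b?) ≡ 𝟙 a? * 𝟙 b?
𝟙-×-dec (yes _) (yes _) = refl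
𝟙-×-dec (yes _) (no _)  = refl
𝟙-×-dec (no _)  _       = refl

length-filter-∷ : ∀ {a p} {A : Set a} {P : A → Set p} (P? : ∀ x → Dec (P x)) x xs →
                  length (filter P? (x ∷ xs)) ≡ 𝟙 (P? x) + length (filter P? xs)
length-filter-∷ P? x xs with does (P? x)
... | true  = refl
... | false = refl

∑-𝟙-∈≡∣p∣ : ∀ {n} (p : Subset n) → ∑[ i < n ] 𝟙 (i ∈? p) ≡ ∣ p ∣
∑-𝟙-∈≡∣p∣ []            = refl
∑-𝟙-∈≡∣p∣ (inside ∷ p)  = cong suc (∑-𝟙-∈≡∣p∣ p)
∑-𝟙-∈≡∣p∣ (outside ∷ p) = ∑-𝟙-∈≡∣p∣ p

∑-𝟙-∈-∉≡∣p∣*𝟙-∉ : ∀ {n} (p : Subset n) y →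
                  ∑[ i < n ] 𝟙 ((i ∈? p) ×-dec ¬? (y ∈? p)) ≡ ∣ p ∣ * 𝟙 (¬? (y ∈? p))
∑-𝟙-∈-∉≡∣p∣*𝟙-∉ {n} p y = begin
  ∑[ i < n ] 𝟙 ((i ∈? p) ×-dec y∉?p)  ≡⟨ sum-cong-≗ (λ i → 𝟙-×-dec (i ∈? p) y∉?p) ⟩
  ∑[ i < n ] (𝟙 (i ∈? p) * 𝟙 y∉?p)   ≡⟨ *-distribʳ-sum (𝟙 y∉?p) (λ i → 𝟙 (i ∈? p)) ⟨
  ∑[ i < n ] 𝟙 (i ∈? p) * 𝟙 y∉?p     ≡⟨ cong (_* 𝟙 y∉?p) (∑-𝟙-∈≡∣p∣ p) ⟩
  ∣ p ∣ * 𝟙 y∉?p                     ∎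
  where
  open ≡-Reasoning
  y∉?p = ¬? (y ∈? p)

∑-b≡k*notContaining : ∀ {n} k (𝓕 : List (Subset n)) → All (λ F → ∣ F ∣ ≡ k) 𝓕 → ∀ y →
                      ∑[ i < n ] b 𝓕 i y ≡ k * notContaining 𝓕 y
∑-b≡k*notContaining {n} k []      []               y = trans (sum-replicate-zero n) (sym (*-zeroʳ k))
∑-b≡k*notContaining {n} k (F ∷ 𝓕) (∣F∣≡k ∷ 𝓕-uniform) y = begin
  ∑[ i < n ] b (F ∷ 𝓕) i y
    ≡⟨ sum-cong-≗ (λ i → length-filter-∷ (λ G → (i ∈? G) ×-dec ¬? (y ∈? G)) F 𝓕) ⟩
  ∑[ i < n ] (𝟙 ((i ∈? F) ×-dec y∉?F) + b 𝓕 i y)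
    ≡⟨ ∑-distrib-+ (λ i → 𝟙 ((i ∈? F) ×-dec y∉?F)) (λ i → b 𝓕 i y) ⟩
  ∑[ i < n ] 𝟙 ((i ∈? F) ×-dec y∉?F) + ∑[ i < n ] b 𝓕 i y
    ≡⟨ cong₂ _+_ (∑-𝟙-∈-∉≡∣p∣*𝟙-∉ F y) (∑-b≡k*notContaining k 𝓕 𝓕-uniform y) ⟩
  ∣ F ∣ * 𝟙 y∉?F + k * notContaining 𝓕 y
    ≡⟨ cong (λ m → m * 𝟙 y∉?F + k * notContaining 𝓕 y) ∣F∣≡k ⟩
  k * 𝟙 y∉?F + k * notContaining 𝓕 y
    ≡⟨ *-distribˡ-+ k (𝟙 y∉?F) (notContaining 𝓕 y) ⟨
  k * (𝟙 y∉?F + notContaining 𝓕 y)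
    ≡⟨ cong (k *_) (length-filter-∷ (λ G → ¬? (y ∈? G)) F 𝓕) ⟨
  k * notContaining (F ∷ 𝓕) y ∎
  where
  open ≡-Reasoning
  y∉?F = ¬? (y ∈? F)

n*m≤∑ : ∀ {n m} (f : Fin n → ℕ) → (∀ i → m ≤ f i) → n * m ≤ ∑[ i < n ] f i
n*m≤∑ {zero}  f m≤f = z≤n
n*m≤∑ {suc n} f m≤f = +-mono-≤ (m≤f Fin.zero) (n*m≤∑ (λ i → f (Fin.suc i)) (λ i → m≤f (Fin.suc i)))

n*m≤∑-punctured : ∀ {n m} (f : Fin (suc n) → ℕ) y → (∀ i → i ≢ y → m ≤ f i) →
                  n * m ≤ ∑[ i < suc n ] f i
n*m≤∑-punctured {n} {m} f y m≤f = begin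
  n * m                              ≤⟨ n*m≤∑ (λ i → f (punchIn y i)) (λ i → m≤f _ (punchInᵢ≢i y i)) ⟩
  sum (λ i → f (punchIn y i))        ≤⟨ m≤n+m _ (f y) ⟩
  f y + sum (λ i → f (punchIn y i))  ≡⟨ sum-remove f ⟨
  sum f                              ∎
  where open ℕ.≤-Reasoning

minimumOr-≤ : ∀ d {xs x} → x ∈ xs → minimumOr d xs ≤ x
minimumOr-≤ d {z ∷ zs} x∈xs =
  foldr-preservesᵒ (λ u v → [ m≤n⇒m⊓o≤n v , m≤n⇒o⊓m≤n u ]′) z zs (from-∈ x∈xs)
  where
  from-∈ : ∀ {x} → x ∈ z ∷ zs → z ≤ x ⊎ Any.Any (_≤ x) zs
  from-∈ (here refl) = inj₁ ≤-refl
  from-∈ (there x∈zs) = inj₂ (Any.map (λ eq → ≤-reflexive (sym eq)) x∈zs)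

minimumOr-∈ : ∀ d x xs → minimumOr d (x ∷ xs) ∈ x ∷ xs
minimumOr-∈ d x xs = [ here , there ]′ (foldr-selective ⊓-sel x xs)

∈-distinctPairs : ∀ {n} {i j : Fin n} → i ≢ j → (i , j) ∈ distinctPairs n
∈-distinctPairs {n} {i} {j} i≢j = ∈-concatMap⁺ _ (Any.map (λ { refl → pair∈ }) (∈-allFin i))
  where
  pair∈ : (i , j) ∈ map (λ j′ → (i , j′)) (filter (λ j′ → ¬? (i ≟ j′)) (allFin n))
  pair∈ = ∈-map⁺ (i ,_) (∈-filter⁺ (λ j′ → ¬? (i ≟ j′)) (∈-allFin j) i≢j)

β≤b : ∀ {n} (𝓕 : List (Subset n)) {i j} → i ≢ j → β 𝓕 ≤ b 𝓕 i j
β≤b 𝓕 i≢j = minimumOr-≤ 0 (∈-map⁺ (λ p → b 𝓕 (proj₁ p) (proj₂ p)) (∈-distinctPairs i≢j))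

γ-attained : ∀ {n} (𝓕 : List (Subset (suc n))) → ∃ λ y → γ 𝓕 ≡ notContaining 𝓕 y
γ-attained {n} 𝓕 = map₂ proj₂ (∈-map⁻ (notContaining 𝓕) γ∈)
  where
  γ∈ : γ 𝓕 ∈ map (notContaining 𝓕) (allFin (suc n))
  γ∈ = minimumOr-∈ 0 _ _

n*β≤k*γ : ∀ {n} k (𝓕 : List (Subset (suc n))) → All (λ F → ∣ F ∣ ≡ k) 𝓕 →
          n * β 𝓕 ≤ k * γ 𝓕
n*β≤k*γ {n} k 𝓕 𝓕-uniform = begin
  n * β 𝓕                 ≤⟨ n*m≤∑-punctured (λ i → b 𝓕 i y) y (λ i → β≤b 𝓕) ⟩
  ∑[ i < suc n ] b 𝓕 i y  ≡⟨ ∑-b≡k*notContaining k 𝓕 𝓕-uniform y ⟩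
  k * notContaining 𝓕 y   ≡⟨ cong (k *_) γ≡ ⟨
  k * γ 𝓕                 ∎
  where
  open ℕ.≤-Reasoning
  y = proj₁ (γ-attained 𝓕)
  γ≡ = proj₂ (γ-attained 𝓕)

corollary3p2 : (n k : ℕ) → 4 ≤ n → 3 ≤ k → (𝓕 : List (Subset n)) → IsKFamily n k 𝓕 →
    k * γ 𝓕 < (n ∸ 1) * ((n ∸ 4) C (k ∸ 3)) →
    β 𝓕 < (n ∸ 4) C (k ∸ 3)
corollary3p2 (suc n) k _ _ 𝓕 (_ , 𝓕-uniform) kγ<nC = ≰⇒> λ C≤β →
  <⇒≱ kγ<nC (≤-trans (*-monoʳ-≤ n C≤β) (n*β≤k*γ k 𝓕 𝓕-uniform))
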